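{- Let $r\geq 2$ and let $H$ and $G$ be $r$-partite $r$-graphs. The $r$-partite constrained Ramsey number $f'(H,G)$ exists if and only if there is a positive integer $t$ such that for all subsets $J\subseteq[r]$, either $H$ is isomorphic to a monochromatic subgraph in a $J$-canonical edge-coloring of $K^{(r)}_{t,\ldots,t}$, or $G$ is isomorphic to a rainbow subgraph in a $J$-canonical edge-coloring of $K^{(r)}_{t,\ldots,t}$.
   Context: An $r$-graph is $r$-partite if its vertex set splits into $V_1,\ldots,V_r$ with every edge meeting each $V_i$ in exactly one vertex. $K^{(r)}_{t,\ldots,t}$ is the complete $r$-partite $r$-graph with parts $V_1,\ldots,V_r$ of size $t$ (all such $r$-sets are edges). For $J\subseteq[r]$ and an edge $e$, write $e_J=e\cap\bigcup_{j\in J}V_j$; an edge-coloring is $J$-canonical if for all edges $e,e'$, $c(e)=c(e')$ iff $e_J=e'_J$. A subgraph is monochromatic if all its edges have the same color and rainbow if its edges have pairwise distinct colors. $f'(H,G)$ is the minimum $n$ such that every edge-coloring of $K^{(r)}_{n,\ldots,n}$ with any number of colors contains a monochromatic copy of $H$ or a rainbow copy of $G$. -}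

module Defs where

open import Data.Nat using (ℕ)
open import Data.Fin using (Fin)
open import Data.Fin.Subset using (Subset; _∈_)
open import Data.Bool using (Bool; T)
open import Data.Product using (_×_; _,_; ∃; Σ)
open import Data.Sum using (_⊎_)
open import Relation.Binary.PropositionalEquality using (_≡_)
open import Function.Definitions using (Injective)

-- An edge meets every class exactly once, so it is encoded as the
-- transversal e : Fin r → Fin nv with e i ∈ V_i (edge = {e i | i}).
record RPGraph (r : ℕ) : Set where
  field
    nv               : ℕ
    part             : Fin nv → Fin r
    IsEdge           : (Fin r → Fin nv) → Bool
    edge-transversal : ∀ e → T (IsEdge e) → ∀ i → part (e i) ≡ i

open RPGraph public

-- K^(r)_{n,...,n}: vertices (i , x) with i the part, x ∈ Fin n the index
-- inside part V_i.  Its edges are exactly the transversals k : Fin r → Fin n,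
-- i.e. the r-sets {(j , k j) | j ∈ Fin r}.
KVertex : ℕ → ℕ → Set
KVertex r n = Fin r × Fin n

KEdge : ℕ → ℕ → Set
KEdge r n = Fin r → Fin n

-- edge-colorings with any number of colors (colors are natural numbers;
-- K has finitely many edges, so this is no restriction)
Coloring : ℕ → ℕ → Set
Coloring r n = KEdge r n → ℕ

-- A copy of H in K^(r)_{n,...,n} (i.e. an isomorphism of H onto a subgraph):
-- an injective vertex map φ such that the image {φ (e i) | i} of every edge
-- e of H is (as a set) an edge {(j , image e p j) | j} of K.
record Copy {r : ℕ} (H : RPGraph r) (n : ℕ) : Set where
  field
    φ          : Fin (nv H) → KVertex r n
    φ-inj      : Injective _≡_ _≡_ φ
    image      : (e : Fin r → Fin (nv H)) → T (IsEdge H e) → KEdge r n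
    image-spec : ∀ e (p : T (IsEdge H e)) →
                   (∀ j → ∃ λ i → φ (e i) ≡ (j , image e p j))
                 × (∀ i → ∃ λ j → φ (e i) ≡ (j , image e p j))

open Copy public

Monochromatic : {r n : ℕ} {H : RPGraph r} → Coloring r n → Copy H n → Set
Monochromatic {r} {n} {H} c C =
  ∃ λ γ → ∀ e (p : T (IsEdge H e)) → c (image C e p) ≡ γ

Rainbow : {r n : ℕ} {H : RPGraph r} → Coloring r n → Copy H n → Set
Rainbow {r} {n} {H} c C =
  ∀ e (p : T (IsEdge H e)) e' (p' : T (IsEdge H e')) →
    c (image C e p) ≡ c (image C e' p') → ∀ i → e i ≡ e' i

Canonical : {r n : ℕ} → Subset r → Coloring r n → Set
Canonical {r} {n} J c =
  ∀ (k k' : KEdge r n) →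
    (c k ≡ c k' → ∀ j → j ∈ J → k j ≡ k' j)
  × ((∀ j → j ∈ J → k j ≡ k' j) → c k ≡ c k')

Arrows : {r : ℕ} → ℕ → RPGraph r → RPGraph r → Set
Arrows {r} n H G =
  ∀ (c : Coloring r n) →
    (∃ λ (C : Copy H n) → Monochromatic c C) ⊎ (∃ λ (C : Copy G n) → Rainbow c C)

-- f'(H,G) exists: some n has the arrow property (then the minimum exists)
FPrimeExists : {r : ℕ} → RPGraph r → RPGraph r → Set
FPrimeExists {r} H G = ∃ λ n → Arrows n H G

{-# OPTIONS --safe #-}
module Submission where

-- If f'(H, G) exists with witness n, color K_{n+1} J-canonically by the J-coordinates of an
-- edge; its restriction to K_n contains a monochromatic H or a rainbow G, which stays so in
-- K_{n+1}. Conversely, the canonical Ramsey theorem for products gives, for every coloring of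
-- K_N with N large, parts of size t on which the coloring is J-canonical for some J, and the
-- J-canonical witness for H or G transfers to these parts because all J-canonical colorings of
-- K_t identify exactly the same pairs of edges.
--
-- The product theorem is proved by induction on r. For a coloring of X × B (X the first
-- coordinate, B an r-dimensional grid): shrink B so that many rows x are canonical on it, and
-- pigeonhole these rows to a common J; shrink X so that every column is constant or injective;
-- the column type is a 2-coloring of B, which the induction hypothesis makes uniform on a
-- subgrid. Constant columns give the coloring J-canonical with the first coordinate ignored;
-- injective columns give it J ∪ {0}-canonical once X is thinned greedily to rows whose colors
-- never meet.

open import Defs
open import Data.Bool using (Bool; true; false; if_then_else_)
import Data.Bool.Properties as Bool
open import Data.Empty using (⊥-elim)
open import Data.Fin using (Fin; zero; suc; toℕ; inject₁; inject≤; fromℕ<; combine; funToFin; finToFun)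
import Data.Fin.Properties as Fin
open import Data.Fin.Properties using (inject≤-injective; pigeonhole; fromℕ<-injective; finToFun-funToFin)
open import Data.Fin.Subset using (Subset; Empty; inside; outside) renaming (_∈_ to _∈ₛ_)
open import Data.Fin.Subset.Properties using (_∈?_)
import Data.List as List
open import Data.List using (List; []; _∷_; _++_; length; filter; map; take; allFin; cartesianProductWith)
open import Data.List.Membership.Propositional using (_∈_; lose)
open import Data.List.Membership.Propositional.Properties
  using (∈-lookup; ∈-cartesianProductWith⁺; ∈-cartesianProductWith⁻)
open import Data.List.Properties using (length-map; length-++; length-take; length-tabulate; filter-none)
open import Data.List.Relation.Binary.Sublist.Propositional
  using (_⊆_; []; _∷_; _∷ʳ_; ⊆-refl; ⊆-trans; minimum)
open import Data.List.Relation.Binary.Sublist.Propositional.Properties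
  using (All-resp-⊆; Any-resp-⊆; filter-⊆; filter⁺; take-⊆; length-mono-≤; map⁺)
open import Data.List.Relation.Unary.All as All using (All; []; _∷_)
import Data.List.Relation.Unary.All.Properties as All
open import Data.List.Relation.Unary.All.Properties using (all-filter)
open import Data.List.Relation.Unary.AllPairs as AllPairs using (AllPairs; []; _∷_)
open import Data.List.Relation.Unary.Any as Any using (Any; here; there; any?)
open import Data.List.Relation.Unary.Unique.Propositional using (Unique)
open import Data.List.Relation.Unary.Unique.Propositional.Properties using (allFin⁺)
import Data.Nat as ℕ
open import Data.Nat using (ℕ; zero; suc; _+_; _*_; _^_; _≤_; _<_; z≤n; s≤s; _≤?_)
open import Data.Nat.GeneralisedArithmetic using (iterate)
open import Data.Nat.Properties
import Data.Product as Product
open import Data.Product using (_×_; _,_; proj₁; proj₂; ∃; ∃-syntax)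
open import Data.Sum as Sum using (_⊎_; inj₁; inj₂; [_,_]′)
import Data.Vec as Vec
open import Data.Vec using (Vec; []; _∷_; here; there)
open import Data.Vec.Properties using (lookup∘tabulate)
open import Data.Vec.Relation.Binary.Pointwise.Inductive as Pointwise using (Pointwise; []; _∷_)
open import Data.Vec.Relation.Unary.All as VecAll using ([]; _∷_) renaming (All to VecAll)
open import Function using (id; _∘_; _⇔_; Equivalence; mk⇔)
open import Function.Definitions using (Injective)
open import Relation.Binary.Definitions using (DecidableEquality)
open import Relation.Binary.PropositionalEquality
open import Relation.Nullary using (Dec; yes; no; ¬_; does)
open import Relation.Unary using (Decidable)
open import Relation.Unary.Properties using (∁?)

module _ {A : Set} where

  AllPairs-resp-⊆ : {R : A → A → Set} {xs ys : List A} → xs ⊆ ys → AllPairs R ys → AllPairs R xs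
  AllPairs-resp-⊆ []         []         = []
  AllPairs-resp-⊆ (_ ∷ʳ τ)   (_  ∷ Rys) = AllPairs-resp-⊆ τ Rys
  AllPairs-resp-⊆ (refl ∷ τ) (Ry ∷ Rys) = All-resp-⊆ τ Ry ∷ AllPairs-resp-⊆ τ Rys

  AllPairs-∈-trichotomy : {R : A → A → Set} {xs : List A} {x y : A} →
                          AllPairs R xs → x ∈ xs → y ∈ xs → x ≡ y ⊎ R x y ⊎ R y x
  AllPairs-∈-trichotomy _         (here refl) (here refl) = inj₁ refl
  AllPairs-∈-trichotomy (Rx ∷ _)  (here refl) (there y∈)  = inj₂ (inj₁ (All.lookup Rx y∈))
  AllPairs-∈-trichotomy (Ry ∷ _)  (there x∈)  (here refl) = inj₂ (inj₂ (All.lookup Ry x∈))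
  AllPairs-∈-trichotomy (_ ∷ Rxs) (there x∈)  (there y∈)  = AllPairs-∈-trichotomy Rxs x∈ y∈

  Unique-lookup-injective : {xs : List A} → Unique xs → ∀ {i j} → List.lookup xs i ≡ List.lookup xs j → i ≡ j
  Unique-lookup-injective {_ ∷ _} _        {zero}  {zero}  _  = refl
  Unique-lookup-injective {_ ∷ _} (x∉ ∷ _) {zero}  {suc j} eq = ⊥-elim (All.lookup x∉ (∈-lookup j) eq)
  Unique-lookup-injective {_ ∷ _} (x∉ ∷ _) {suc i} {zero}  eq = ⊥-elim (All.lookup x∉ (∈-lookup i) (sym eq))
  Unique-lookup-injective {_ ∷ _} (_ ∷ u)  {suc i} {suc j} eq = cong suc (Unique-lookup-injective u eq)

  two-distinct : {xs : List A} → Unique xs → 2 ≤ length xs → ∃[ x ] ∃[ y ] x ∈ xs × y ∈ xs × x ≢ y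
  two-distinct {_ ∷ []}    _                (s≤s ())
  two-distinct {x ∷ y ∷ _} ((x≢y ∷ _) ∷ _) _ = x , y , here refl , there (here refl) , x≢y

  length-take-≤ : {m : ℕ} (xs : List A) → m ≤ length xs → length (take m xs) ≡ m
  length-take-≤ {m} xs m≤ = trans (length-take m xs) (m≤n⇒m⊓n≡m m≤)

  module _ {P : A → Set} (P? : Decidable P) where

    length-filter+filter-∁ : ∀ xs → length (filter P? xs) + length (filter (∁? P?) xs) ≡ length xs
    length-filter+filter-∁ []       = refl
    length-filter+filter-∁ (x ∷ xs) with P? x
    ... | yes _ = cong suc (length-filter+filter-∁ xs)
    ... | no  _ = trans (+-suc _ _) (cong suc (length-filter+filter-∁ xs))

    length-filter-mono : {xs ys : List A} → xs ⊆ ys → length (filter P? xs) ≤ length (filter P? ys)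
    length-filter-mono τ = length-mono-≤ (filter⁺ P? P? (λ { refl p → p }) τ)

  length-filter-⊎ : {P Q S : A → Set} (P? : Decidable P) (Q? : Decidable Q) (S? : Decidable S) →
                    (∀ {x} → S x → P x ⊎ Q x) →
                    ∀ xs → length (filter S? xs) ≤ length (filter P? xs) + length (filter Q? xs)
  length-filter-⊎ P? Q? S? S⇒P⊎Q []       = z≤n
  length-filter-⊎ P? Q? S? S⇒P⊎Q (x ∷ xs) with S? x
  ... | no _ = ≤-trans (length-filter-⊎ P? Q? S? S⇒P⊎Q xs)
                       (+-mono-≤ (length-filter-mono P? (x ∷ʳ ⊆-refl)) (length-filter-mono Q? (x ∷ʳ ⊆-refl)))
  ... | yes s with P? x | Q? x | length-filter-⊎ P? Q? S? S⇒P⊎Q xs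
  ...   | yes _ | yes _ | ih = s≤s (≤-trans ih (+-monoʳ-≤ _ (n≤1+n _)))
  ...   | yes _ | no  _ | ih = s≤s ih
  ...   | no  _ | yes _ | ih = ≤-trans (s≤s ih) (≤-reflexive (sym (+-suc _ _)))
  ...   | no ¬p | no ¬q | _  = ⊥-elim ([ ¬p , ¬q ]′ (S⇒P⊎Q s))

  length-filter-any : {B : Set} {P : B → A → Set} (P? : ∀ b → Decidable (P b)) {k : ℕ} (bs : List B) {xs : List A} →
                      (∀ {b} → b ∈ bs → length (filter (P? b) xs) ≤ k) →
                      length (filter (λ x → any? (λ b → P? b x) bs) xs) ≤ length bs * k
  length-filter-any P? []       {xs} _     = ≤-reflexive (cong length (filter-none _ (All.universal (λ _ ()) xs)))
  length-filter-any P? (b ∷ bs) {xs} bound =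
    ≤-trans (length-filter-⊎ (P? b) (λ x → any? (λ b → P? b x) bs) _ Any.toSum xs)
            (+-mono-≤ (bound (here refl)) (length-filter-any P? bs {xs} (bound ∘ there)))

length-cartesianProductWith : {A B C : Set} (f : A → B → C) (xs : List A) (ys : List B) →
                              length (cartesianProductWith f xs ys) ≡ length xs * length ys
length-cartesianProductWith f []       ys = refl
length-cartesianProductWith f (x ∷ xs) ys = begin
  length (map (f x) ys ++ cartesianProductWith f xs ys)         ≡⟨ length-++ (map (f x) ys) ⟩
  length (map (f x) ys) + length (cartesianProductWith f xs ys) ≡⟨ cong₂ _+_ (length-map (f x) ys)
                                                                            (length-cartesianProductWith f xs ys) ⟩
  length ys + length xs * length ys                              ∎
  where open ≡-Reasoning

module _ {A D : Set} where

  ConstantOn : (A → D) → List A → Set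
  ConstantOn f xs = ∃[ d ] All (λ x → f x ≡ d) xs

  InjectiveOn : (A → D) → List A → Set
  InjectiveOn f xs = AllPairs (λ x y → f x ≢ f y) xs

  ConstantOrInjectiveOn : (A → D) → List A → Set
  ConstantOrInjectiveOn f xs = ConstantOn f xs ⊎ InjectiveOn f xs

  ConstantOrInjectiveOn-resp-⊆ : {f : A → D} {xs ys : List A} → xs ⊆ ys →
                                  ConstantOrInjectiveOn f ys → ConstantOrInjectiveOn f xs
  ConstantOrInjectiveOn-resp-⊆ τ (inj₁ (d , fx≡d)) = inj₁ (d , All-resp-⊆ τ fx≡d)
  ConstantOrInjectiveOn-resp-⊆ τ (inj₂ f-inj)      = inj₂ (AllPairs-resp-⊆ τ f-inj)

  module _ {f : A → D} {xs : List A} {x y : A} (x∈ : x ∈ xs) (y∈ : y ∈ xs) where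

    ConstantOn-≡ : ConstantOn f xs → f x ≡ f y
    ConstantOn-≡ (_ , fx≡d) = trans (All.lookup fx≡d x∈) (sym (All.lookup fx≡d y∈))

    InjectiveOn-≢ : InjectiveOn f xs → x ≢ y → f x ≢ f y
    InjectiveOn-≢ f-inj x≢y fx≡fy with AllPairs-∈-trichotomy f-inj x∈ y∈
    ... | inj₁ x≡y           = x≢y x≡y
    ... | inj₂ (inj₁ fx≢fy) = fx≢fy fx≡fy
    ... | inj₂ (inj₂ fy≢fx) = fy≢fx (sym fx≡fy)

    ConstantOrInjectiveOn-resolve : ConstantOrInjectiveOn f xs → x ≢ y →
                                    (f x ≡ f y → ConstantOn f xs) × (f x ≢ f y → InjectiveOn f xs)
    ConstantOrInjectiveOn-resolve (inj₁ const) _   = (λ _ → const) , (λ fx≢fy → ⊥-elim (fx≢fy (ConstantOn-≡ const)))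
    ConstantOrInjectiveOn-resolve (inj₂ f-inj) x≢y = (λ fx≡fy → ⊥-elim (InjectiveOn-≢ f-inj x≢y fx≡fy)) , (λ _ → f-inj)

iterSq : ℕ → ℕ → ℕ
iterSq zero    m = m
iterSq (suc k) m = suc (iterSq k m * iterSq k m)

module _ {A D : Set} (_≟_ : DecidableEquality D) where

  length-fiber≤1 : {f : A → D} {xs : List A} → InjectiveOn f xs → ∀ d → length (filter (λ x → f x ≟ d) xs) ≤ 1
  length-fiber≤1 {f} {xs} f-inj d = atMostOne (AllPairs-resp-⊆ (filter-⊆ _ xs) f-inj) (all-filter _ xs)
    where
      atMostOne : {ys : List A} → InjectiveOn f ys → All (λ x → f x ≡ d) ys → length ys ≤ 1
      atMostOne {[]}        _                 _                  = z≤n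
      atMostOne {_ ∷ []}    _                 _                  = ≤-refl
      atMostOne {_ ∷ _ ∷ _} ((fx≢fy ∷ _) ∷ _) (fx≡d ∷ fy≡d ∷ _) = ⊥-elim (fx≢fy (trans fx≡d (sym fy≡d)))

  sameValue? : (f : A → D) (x : A) → Decidable (λ y → f y ≡ f x)
  sameValue? f x y = f y ≟ f x

  constant-or-injective : (f : A → D) (a b : ℕ) (xs : List A) → a * b < length xs →
    ∃[ ys ] ys ⊆ xs × (a ≤ length ys × ConstantOn f ys ⊎ b ≤ length ys × InjectiveOn f ys)
  constant-or-injective f a zero    xs       _         = [] , minimum xs , inj₂ (z≤n , [])
  constant-or-injective f a (suc b) (x ∷ xs) (s≤s ab≤) with a ≤? length (x ∷ filter (sameValue? f x) xs)
  ... | yes a≤ = x ∷ filter (sameValue? f x) xs , refl ∷ filter-⊆ _ xs , inj₁ (a≤ , f x , refl ∷ all-filter _ xs)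
  ... | no  a≰ with constant-or-injective f a b (filter (∁? (sameValue? f x)) xs) ab<
    where
      ab< : a * b < length (filter (∁? (sameValue? f x)) xs)
      ab< = +-cancelˡ-< (length (filter (sameValue? f x) xs)) _ _ (begin-strict
        length (filter (sameValue? f x) xs) + a * b     <⟨ +-monoˡ-< (a * b) (≤-trans (n≤1+n _) (≰⇒> a≰)) ⟩
        a + a * b                                       ≡⟨ *-suc a b ⟨
        a * suc b                                       ≤⟨ ab≤ ⟩
        length xs                                       ≡⟨ length-filter+filter-∁ (sameValue? f x) xs ⟨
        length (filter (sameValue? f x) xs) + length (filter (∁? (sameValue? f x)) xs) ∎)
        where open ≤-Reasoning
  ...   | ys , ys⊆ , inj₁ const        = ys , x ∷ʳ ⊆-trans ys⊆ (filter-⊆ _ xs) , inj₁ const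
  ...   | ys , ys⊆ , inj₂ (b≤ , f-inj) =
    x ∷ ys , refl ∷ ⊆-trans ys⊆ (filter-⊆ _ xs) ,
    inj₂ (s≤s b≤ , All.map ≢-sym (All-resp-⊆ ys⊆ (all-filter _ xs)) ∷ f-inj)

  constant-or-injective-all : (fs : List (A → D)) {m : ℕ} (xs : List A) → iterSq (length fs) m ≤ length xs →
    ∃[ ys ] ys ⊆ xs × m ≤ length ys × All (λ f → ConstantOrInjectiveOn f ys) fs
  constant-or-injective-all []       xs m≤ = xs , ⊆-refl , m≤ , []
  constant-or-injective-all (f ∷ fs) xs le with constant-or-injective f _ _ xs le
  ... | ys , ys⊆ , coi with constant-or-injective-all fs ys ([ proj₁ , proj₁ ]′ coi)
  ...   | zs , zs⊆ , m≤ , cois =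
    zs , ⊆-trans zs⊆ ys⊆ , m≤ , ConstantOrInjectiveOn-resp-⊆ zs⊆ (Sum.map proj₂ proj₂ coi) ∷ cois

module _ {A : Set} where

  ¬InjectiveOn-Bool : (g : A → Bool) {xs : List A} → 3 ≤ length xs → ¬ InjectiveOn g xs
  ¬InjectiveOn-Bool g {_ ∷ []}     (s≤s ())
  ¬InjectiveOn-Bool g {_ ∷ _ ∷ []} (s≤s (s≤s ()))
  ¬InjectiveOn-Bool g {x ∷ y ∷ z ∷ _} _ ((gx≢gy ∷ gx≢gz ∷ _) ∷ (gy≢gz ∷ _) ∷ _) with g x | g y | g z
  ... | true  | true  | _     = gx≢gy refl
  ... | false | false | _     = gx≢gy refl
  ... | true  | false | true  = gx≢gz refl
  ... | false | true  | false = gx≢gz refl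
  ... | _     | true  | true  = gy≢gz refl
  ... | _     | false | false = gy≢gz refl

pigeonholeBound : ℕ → ℕ → ℕ
pigeonholeBound zero    m = m
pigeonholeBound (suc r) m = suc (pigeonholeBound r m * 3)

module _ {A : Set} where

  pigeonhole-Subset : ∀ {r m} (f : A → Subset r) (xs : List A) → pigeonholeBound r m ≤ length xs →
    ∃[ ys ] ys ⊆ xs × m ≤ length ys × ∃[ J ] All (λ x → f x ≡ J) ys
  pigeonhole-Subset {zero} f xs m≤ = xs , ⊆-refl , m≤ , [] , All.universal (λ x → Subset₀-η (f x)) xs
    where
      Subset₀-η : (J : Subset 0) → J ≡ []
      Subset₀-η [] = refl
  pigeonhole-Subset {suc r} f xs le with constant-or-injective Bool._≟_ (Vec.head ∘ f) _ 3 xs le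
  ... | _  , _   , inj₂ (3≤ , head-inj)          = ⊥-elim (¬InjectiveOn-Bool (Vec.head ∘ f) 3≤ head-inj)
  ... | ys , ys⊆ , inj₁ (ph≤ , b , heads≡) with pigeonhole-Subset (Vec.tail ∘ f) ys ph≤
  ...   | zs , zs⊆ , m≤ , J , tails≡ =
    zs , ⊆-trans zs⊆ ys⊆ , m≤ , b ∷ J ,
    All.zipWith (λ (head≡ , tail≡) → trans (head∷tail (f _)) (cong₂ _∷_ head≡ tail≡)) (All-resp-⊆ zs⊆ heads≡ , tails≡)
    where
      head∷tail : ∀ {n} (J : Subset (suc n)) → J ≡ Vec.head J ∷ Vec.tail J
      head∷tail (_ ∷ _) = refl

module _ {A : Set} where

  map-proj₁-toList : {P : A → Set} {xs : List A} (pxs : All P xs) → map proj₁ (All.toList pxs) ≡ xs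
  map-proj₁-toList []        = refl
  map-proj₁-toList (_ ∷ pxs) = cong (_ ∷_) (map-proj₁-toList pxs)

  pigeonhole-All : ∀ {r m} {Q : A → Subset r → Set} {xs : List A} → All (λ x → ∃ (Q x)) xs →
    pigeonholeBound r m ≤ length xs → ∃[ ys ] ys ⊆ xs × m ≤ length ys × ∃[ J ] All (λ x → Q x J) ys
  pigeonhole-All {r} {m} {Q} Qs le
    with pigeonhole-Subset {r = r} {m} (λ (p : ∃ λ x → ∃ (Q x)) → proj₁ (proj₂ p)) (All.toList Qs)
           (subst (_ ≤_) (trans (cong length (sym (map-proj₁-toList Qs))) (length-map proj₁ (All.toList Qs))) le)
  ... | ys , ys⊆ , m≤ , J , labels≡ =
    map proj₁ ys ,
    subst (map proj₁ ys ⊆_) (map-proj₁-toList Qs) (map⁺ proj₁ ys⊆) ,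
    subst (_ ≤_) (sym (length-map proj₁ ys)) m≤ ,
    J , All.map⁺ (All.map (λ { {x , J′ , q} refl → q }) labels≡)

module _ {A : Set} {_~_ : A → A → Set} (_~?_ : ∀ x y → Dec (x ~ y)) where

  independent : ℕ → List A → List A
  independent zero    _        = []
  independent (suc m) []       = []
  independent (suc m) (x ∷ xs) = x ∷ independent m (filter (∁? (x ~?_)) xs)

  independent-⊆ : ∀ m xs → independent m xs ⊆ xs
  independent-⊆ zero    xs       = minimum xs
  independent-⊆ (suc m) []       = []
  independent-⊆ (suc m) (x ∷ xs) = refl ∷ ⊆-trans (independent-⊆ m _) (filter-⊆ _ xs)

  independent-AllPairs : ∀ m xs → AllPairs (λ x y → ¬ x ~ y) (independent m xs)
  independent-AllPairs zero    _        = []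
  independent-AllPairs (suc m) []       = []
  independent-AllPairs (suc m) (x ∷ xs) =
    All-resp-⊆ (independent-⊆ m _) (all-filter _ xs) ∷ independent-AllPairs m _

  length-independent : ∀ {Δ} m xs → (∀ x → length (filter (x ~?_) xs) ≤ Δ) → m * suc Δ ≤ length xs →
                       m ≤ length (independent m xs)
  length-independent zero    _        _      _         = z≤n
  length-independent (suc m) (x ∷ xs) degree (s≤s le) =
    s≤s (length-independent m rest (λ y → ≤-trans (length-filter-mono (y ~?_) (x ∷ʳ filter-⊆ _ xs)) (degree y)) le′)
    where
      rest = filter (∁? (x ~?_)) xs
      le′ : m * suc _ ≤ length rest
      le′ = +-cancelˡ-≤ (length (filter (x ~?_) xs)) _ _ (begin
        length (filter (x ~?_) xs) + m * suc _   ≤⟨ +-monoˡ-≤ _ (≤-trans (length-filter-mono (x ~?_) (x ∷ʳ ⊆-refl))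
                                                                            (degree x)) ⟩
        _ + m * suc _                            ≤⟨ le ⟩
        length xs                                ≡⟨ length-filter+filter-∁ (x ~?_) xs ⟨
        length (filter (x ~?_) xs) + length rest ∎)
        where open ≤-Reasoning

-- Grids

Grid : Set → ℕ → Set
Grid A r = Vec (List A) r

module _ {A : Set} {r : ℕ} where

  _∈ᵍ_ : Vec A r → Grid A r → Set
  v ∈ᵍ G = Pointwise _∈_ v G

  _⊆ᵍ_ : Grid A r → Grid A r → Set
  G′ ⊆ᵍ G = Pointwise _⊆_ G′ G

  Sized : ℕ → Grid A r → Set
  Sized t G = VecAll (λ X → Unique X × t ≤ length X) G

  Agree : Subset r → Vec A r → Vec A r → Set
  Agree J v w = ∀ j → j ∈ₛ J → Vec.lookup v j ≡ Vec.lookup w j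

  CanonicalOn : Subset r → Grid A r → (Vec A r → ℕ) → Set
  CanonicalOn J G c = ∀ {v w} → v ∈ᵍ G → w ∈ᵍ G → c v ≡ c w ⇔ Agree J v w

  ∈ᵍ-resp-⊆ᵍ : {G′ G : Grid A r} {v : Vec A r} → G′ ⊆ᵍ G → v ∈ᵍ G′ → v ∈ᵍ G
  ∈ᵍ-resp-⊆ᵍ G′⊆G v∈G′ = Pointwise.trans (λ x∈ X⊆ → Any-resp-⊆ X⊆ x∈) v∈G′ G′⊆G

  ⊆ᵍ-trans : {G″ G′ G : Grid A r} → G″ ⊆ᵍ G′ → G′ ⊆ᵍ G → G″ ⊆ᵍ G
  ⊆ᵍ-trans = Pointwise.trans ⊆-trans

  Sized-weaken : {m n : ℕ} {G : Grid A r} → m ≤ n → Sized n G → Sized m G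
  Sized-weaken m≤n = VecAll.map (Product.map₂ (≤-trans m≤n))

  CanonicalOn-resp-⊆ᵍ : {J : Subset r} {G′ G : Grid A r} {c : Vec A r → ℕ} →
                        G′ ⊆ᵍ G → CanonicalOn J G c → CanonicalOn J G′ c
  CanonicalOn-resp-⊆ᵍ G′⊆G can v∈ w∈ = can (∈ᵍ-resp-⊆ᵍ G′⊆G v∈) (∈ᵍ-resp-⊆ᵍ G′⊆G w∈)

  Agree-∅ : {J : Subset r} → Empty J → ∀ v w → Agree J v w
  Agree-∅ J-empty _ _ j j∈J = ⊥-elim (J-empty (j , j∈J))

module _ {A : Set} {r : ℕ} {J : Subset r} {x y : A} {v w : Vec A r} where

  Agree-outside : Agree (outside ∷ J) (x ∷ v) (y ∷ w) ⇔ Agree J v w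
  Agree-outside = mk⇔ (λ agree j j∈J → agree (suc j) (there j∈J))
                      (λ { agree (suc j) (there j∈J) → agree j j∈J })

  Agree-inside : Agree (inside ∷ J) (x ∷ v) (y ∷ w) ⇔ (x ≡ y × Agree J v w)
  Agree-inside = mk⇔ (λ agree → agree zero here , λ j j∈J → agree (suc j) (there j∈J))
                     (λ { (x≡y , _) zero here → x≡y ; (_ , agree) (suc j) (there j∈J) → agree j j∈J })

module _ {A : Set} where

  points : ∀ {r} → Grid A r → List (Vec A r)
  points []      = [] ∷ []
  points (X ∷ G) = cartesianProductWith _∷_ X (points G)

  ∈ᵍ⇒∈-points : ∀ {r} {G : Grid A r} {v : Vec A r} → v ∈ᵍ G → v ∈ points G
  ∈ᵍ⇒∈-points []          = here refl
  ∈ᵍ⇒∈-points (x∈X ∷ v∈G) = ∈-cartesianProductWith⁺ _∷_ x∈X (∈ᵍ⇒∈-points v∈G)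

  ∈-points⇒∈ᵍ : ∀ {r} {G : Grid A r} {v : Vec A r} → v ∈ points G → v ∈ᵍ G
  ∈-points⇒∈ᵍ {G = []}    (here refl) = []
  ∈-points⇒∈ᵍ {G = X ∷ G} v∈ with ∈-cartesianProductWith⁻ _∷_ X (points G) v∈
  ... | _ , _ , x∈X , v∈G , refl = x∈X ∷ ∈-points⇒∈ᵍ v∈G

  trim : ∀ {r} t (G : Grid A r) → Sized t G → ∃[ G′ ] G′ ⊆ᵍ G × Sized t G′ × length (points G′) ≡ t ^ r
  trim t []      []                        = [] , [] , [] , refl
  trim t (X ∷ G) ((X-unique , t≤) ∷ sized) with trim t G sized
  ... | G′ , G′⊆G , sized′ , |points| =
    take t X ∷ G′ ,
    take-⊆ t X ∷ G′⊆G ,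
    (AllPairs-resp-⊆ (take-⊆ t X) X-unique , ≤-reflexive (sym (length-take-≤ X t≤))) ∷ sized′ ,
    trans (length-cartesianProductWith _∷_ (take t X) (points G′)) (cong₂ _*_ (length-take-≤ X t≤) |points|)

  Sized-replicate : ∀ r {t} {X : List A} → Unique X → t ≤ length X → Sized t (Vec.replicate r X)
  Sized-replicate zero    _        _  = []
  Sized-replicate (suc r) X-unique t≤ = (X-unique , t≤) ∷ Sized-replicate r X-unique t≤

  embedding : ∀ {r t} {G : Grid A r} → Sized t G → Fin r → Fin t → A
  embedding {G = X ∷ _} ((_ , t≤) ∷ _) zero    i = List.lookup X (inject≤ i t≤)
  embedding             (_ ∷ sized)    (suc j) i = embedding sized j i

  embedding-injective : ∀ {r t} {G : Grid A r} (sized : Sized t G) j → Injective _≡_ _≡_ (embedding sized j)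
  embedding-injective ((X-unique , t≤) ∷ _) zero    eq = inject≤-injective t≤ t≤ _ _ (Unique-lookup-injective X-unique eq)
  embedding-injective (_ ∷ sized)           (suc j) eq = embedding-injective sized j eq

  embed : ∀ {r t} {G : Grid A r} → Sized t G → KEdge r t → Vec A r
  embed sized k = Vec.tabulate (λ j → embedding sized j (k j))

  embed-∈ᵍ : ∀ {r t} {G : Grid A r} (sized : Sized t G) (k : KEdge r t) → embed sized k ∈ᵍ G
  embed-∈ᵍ []          k = []
  embed-∈ᵍ (_ ∷ sized) k = ∈-lookup _ ∷ embed-∈ᵍ sized (k ∘ suc)

  CanonicalOn⇒Canonical : ∀ {r t} {G : Grid A r} {J : Subset r} {c : Vec A r → ℕ} (sized : Sized t G) →
                          CanonicalOn J G c → Canonical J (c ∘ embed sized)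
  CanonicalOn⇒Canonical sized can k k′ =
    (λ same j j∈J → embedding-injective sized j
       (trans (sym (lookup-embed k j)) (trans (Equivalence.to (can′ k k′) same j j∈J) (lookup-embed k′ j)))) ,
    (λ agree → Equivalence.from (can′ k k′) λ j j∈J →
       trans (lookup-embed k j) (trans (cong (embedding sized j) (agree j j∈J)) (sym (lookup-embed k′ j))))
    where
      can′ : ∀ k k′ → _
      can′ k k′ = can (embed-∈ᵍ sized k) (embed-∈ᵍ sized k′)
      lookup-embed : ∀ k j → Vec.lookup (embed sized k) j ≡ embedding sized j (k j)
      lookup-embed k = lookup∘tabulate (λ j → embedding sized j (k j))

fewColors⇒Empty : ∀ {r n m} {J : Subset r} {c : Coloring r n} → Canonical J c → (∀ k → c k < m) → m < n → Empty J
fewColors⇒Empty {c = c} can c<m m<n (j , j∈J) with pigeonhole m<n (λ i → fromℕ< (c<m (λ _ → i)))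
... | i , i′ , i<i′ , same =
  Fin.<⇒≢ i<i′ (proj₁ (can (λ _ → i) (λ _ → i′)) (fromℕ<-injective _ _ (c<m _) (c<m _) same) j j∈J)

fewColors⇒constant : ∀ {A r n m} {G : Grid A r} {J : Subset r} {c : Vec A r → ℕ} → Sized n G →
                      CanonicalOn J G c → (∀ v → c v < m) → m < n → ∀ {v w} → v ∈ᵍ G → w ∈ᵍ G → c v ≡ c w
fewColors⇒constant sized can c<m m<n {v} {w} v∈ w∈ =
  Equivalence.from (can v∈ w∈) (Agree-∅ (fewColors⇒Empty (CanonicalOn⇒Canonical sized can) (c<m ∘ _) m<n) v w)

indicator : {X : Set} {P : X → Set} → Decidable P → X → ℕ
indicator P? x = if does (P? x) then 1 else 0

module _ {X : Set} {P : X → Set} (P? : Decidable P) where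

  indicator<2 : ∀ x → indicator P? x < 2
  indicator<2 x with P? x
  ... | yes _ = ≤-refl
  ... | no  _ = s≤s z≤n

  indicator-≡⇒ : ∀ {x y} → indicator P? x ≡ indicator P? y → P x → P y
  indicator-≡⇒ {x} {y} same px with P? x | P? y | same
  ... | _      | yes py | _  = py
  ... | yes _  | no  _  | ()
  ... | no ¬px | no  _  | _  = ⊥-elim (¬px px)

module _ {A : Set} {r : ℕ} (c : Vec A (suc r) → ℕ) where

  row : A → Vec A r → ℕ
  row x y = c (x ∷ y)

  column : Vec A r → A → ℕ
  column y x = c (x ∷ y)

  RowsCanonical : Subset r → List A → Grid A r → Set
  RowsCanonical J X B = All (λ x → CanonicalOn J B (row x)) X

  RowsCanonical-resp : ∀ {J X′ X B′ B} → X′ ⊆ X → B′ ⊆ᵍ B → RowsCanonical J X B → RowsCanonical J X′ B′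
  RowsCanonical-resp X′⊆X B′⊆B rows = All.map (CanonicalOn-resp-⊆ᵍ B′⊆B) (All-resp-⊆ X′⊆X rows)

  Separated : Grid A r → A → A → Set
  Separated B x x′ = ∀ {y y′} → y ∈ᵍ B → y′ ∈ᵍ B → c (x ∷ y) ≢ c (x′ ∷ y′)

  Conflict : List (Vec A r) → A → A → Set
  Conflict P x x′ = Any (λ y → Any (λ y′ → c (x′ ∷ y′) ≡ c (x ∷ y)) P) P

  conflict? : ∀ P x x′ → Dec (Conflict P x x′)
  conflict? P x x′ = any? (λ y → any? (λ y′ → c (x′ ∷ y′) ℕ.≟ c (x ∷ y)) P) P

  conflict-degree : ∀ {X P} → (∀ {y} → y ∈ P → InjectiveOn (column y) X) →
                    ∀ x → length (filter (conflict? P x) X) ≤ length P * length P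
  conflict-degree {X} {P} columns-inj x =
    length-filter-any _ P {X} λ {y} _ →
      ≤-trans (length-filter-any _ P {X} λ y′∈P → length-fiber≤1 ℕ._≟_ (columns-inj y′∈P) (c (x ∷ y)))
              (≤-reflexive (*-identityʳ _))

  ¬Conflict⇒Separated : ∀ {B x x′} → ¬ Conflict (points B) x x′ → Separated B x x′
  ¬Conflict⇒Separated no-conflict y∈B y′∈B same =
    no-conflict (lose (∈ᵍ⇒∈-points y∈B) (lose (∈ᵍ⇒∈-points y′∈B) (sym same)))

  canonical-constantColumns : ∀ {J X B} → RowsCanonical J X B → (∀ {y} → y ∈ᵍ B → ConstantOn (column y) X) →
                              CanonicalOn (outside ∷ J) (X ∷ B) c
  canonical-constantColumns rows constant {x ∷ y} {x′ ∷ y′} (x∈X ∷ y∈B) (x′∈X ∷ y′∈B) = mk⇔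
    (λ same → Equivalence.from Agree-outside
       (Equivalence.to (All.lookup rows x′∈X y∈B y′∈B) (trans (ConstantOn-≡ x′∈X x∈X (constant y∈B)) same)))
    (λ agree → trans (Equivalence.from (All.lookup rows x∈X y∈B y′∈B) (Equivalence.to Agree-outside agree))
                     (ConstantOn-≡ x∈X x′∈X (constant y′∈B)))

  canonical-separatedRows : ∀ {J X B} → RowsCanonical J X B → AllPairs (Separated B) X →
                            CanonicalOn (inside ∷ J) (X ∷ B) c
  canonical-separatedRows rows separated {x ∷ y} {x′ ∷ y′} (x∈X ∷ y∈B) (x′∈X ∷ y′∈B) = mk⇔ to from
    where
      to : c (x ∷ y) ≡ c (x′ ∷ y′) → Agree (inside ∷ _) (x ∷ y) (x′ ∷ y′)
      to same with AllPairs-∈-trichotomy separated x∈X x′∈X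
      ... | inj₁ refl        = Equivalence.from Agree-inside (refl , Equivalence.to (All.lookup rows x∈X y∈B y′∈B) same)
      ... | inj₂ (inj₁ x⊥x′) = ⊥-elim (x⊥x′ y∈B y′∈B same)
      ... | inj₂ (inj₂ x′⊥x) = ⊥-elim (x′⊥x y′∈B y∈B (sym same))

      from : Agree (inside ∷ _) (x ∷ y) (x′ ∷ y′) → c (x ∷ y) ≡ c (x′ ∷ y′)
      from agree with Equivalence.to Agree-inside agree
      ... | refl , agreeᵣ = Equivalence.from (All.lookup rows x∈X y∈B y′∈B) agreeᵣ

-- The canonical Ramsey theorem for grids

CanonicalRamseyAt : Set → ℕ → ℕ → ℕ → Set
CanonicalRamseyAt A r t N = (G : Grid A r) → Sized N G → (c : Vec A r → ℕ) →
  ∃[ G′ ] G′ ⊆ᵍ G × Sized t G′ × ∃[ J ] CanonicalOn J G′ c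

-- Read backwards: T rows survive the greedy separation of m₃ rows against the (T ^ r)² color
-- clashes each row can have; m₂ rows leave m₃ once the s ^ r columns are made constant or
-- injective; m₁ rows leave m₂ with a common subset J; the grid must survive m₁ applications of the
-- induction hypothesis. T ≥ 3 makes a canonical 2-coloring constant.
module StepBound (b : ℕ → ℕ) (r t : ℕ) where

  T s m₃ m₂ m₁ N : ℕ
  T  = 3 + t
  s  = b T
  m₃ = T * suc (T ^ r * T ^ r)
  m₂ = iterSq (s ^ r) m₃
  m₁ = pigeonholeBound r m₂
  N  = m₁ + iterate b s m₁

ramseyBound : ℕ → ℕ → ℕ
ramseyBound zero    t = 0
ramseyBound (suc r) t = StepBound.N (ramseyBound r) r t

module _ {A : Set} {r : ℕ} {b : ℕ → ℕ} (IH : ∀ t → CanonicalRamseyAt A r t (b t)) where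

  canonical-all : ∀ t (cs : List (Vec A r → ℕ)) {G : Grid A r} → Sized (iterate b t (length cs)) G →
    ∃[ G′ ] G′ ⊆ᵍ G × Sized t G′ × All (λ c → ∃[ J ] CanonicalOn J G′ c) cs
  canonical-all t []       sized = _ , Pointwise.refl ⊆-refl , sized , []
  canonical-all t (c ∷ cs) sized with canonical-all (b t) cs sized
  ... | G₁ , G₁⊆G , sized₁ , cans with IH t G₁ sized₁ c
  ... | G₂ , G₂⊆G₁ , sized₂ , J , can =
    G₂ , ⊆ᵍ-trans G₂⊆G₁ G₁⊆G , sized₂ , (J , can) ∷ All.map (Product.map₂ (CanonicalOn-resp-⊆ᵍ G₂⊆G₁)) cans

  monochromatic-subgrid : ∀ {t} {P : Vec A r → Set} → Decidable P → 2 < t → (G : Grid A r) → Sized (b t) G →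
    ∃[ G′ ] G′ ⊆ᵍ G × Sized t G′ × ((∀ {v} → v ∈ᵍ G′ → P v) ⊎ (∀ {v} → v ∈ᵍ G′ → ¬ P v))
  monochromatic-subgrid {suc t} {P} P? 2<t G sized with IH (suc t) G sized (indicator P?)
  ... | G′ , G′⊆G , sized′ , J , can = G′ , G′⊆G , sized′ , dichotomy (P? v₀)
    where
      v₀ = embed sized′ (λ _ → zero)
      v₀∈ = embed-∈ᵍ sized′ (λ _ → zero)

      same : ∀ {v w} → v ∈ᵍ G′ → w ∈ᵍ G′ → indicator P? v ≡ indicator P? w
      same = fewColors⇒constant sized′ can (indicator<2 P?) 2<t

      dichotomy : Dec (P v₀) → (∀ {v} → v ∈ᵍ G′ → P v) ⊎ (∀ {v} → v ∈ᵍ G′ → ¬ P v)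
      dichotomy (yes pv₀) = inj₁ λ v∈ → indicator-≡⇒ P? (same v₀∈ v∈) pv₀
      dichotomy (no ¬pv₀) = inj₂ λ v∈ pv → ¬pv₀ (indicator-≡⇒ P? (same v∈ v₀∈) pv)

module Step {A : Set} (r t : ℕ) (IH : ∀ t → CanonicalRamseyAt A r t (ramseyBound r t)) (c : Vec A (suc r) → ℕ) where

  open StepBound (ramseyBound r) r t

  T≤m₃ : T ≤ m₃
  T≤m₃ = m≤m*n T (suc _)

  uniformRows : (X₀ : List A) (B₀ : Grid A r) → m₁ ≤ length X₀ → Sized (iterate (ramseyBound r) s m₁) B₀ →
    ∃[ X ] X ⊆ X₀ × m₂ ≤ length X × ∃[ B ] B ⊆ᵍ B₀ × Sized s B × ∃[ J ] RowsCanonical c J X B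
  uniformRows X₀ B₀ m₁≤ sized
    with canonical-all IH s (map (row c) (take m₁ X₀))
           (subst (λ n → Sized (iterate _ s n) B₀)
                  (sym (trans (length-map (row c) (take m₁ X₀)) (length-take-≤ X₀ m₁≤))) sized)
  ... | B , B⊆B₀ , sizedB , cans
    with pigeonhole-All {r = r} {m₂} (All.map⁻ cans) (≤-reflexive (sym (length-take-≤ X₀ m₁≤)))
  ... | X , X⊆ , m₂≤ , J , rows = X , ⊆-trans X⊆ (take-⊆ m₁ X₀) , m₂≤ , B , B⊆B₀ , sizedB , J , rows

  uniformColumns : (X : List A) → Unique X → m₂ ≤ length X → (B : Grid A r) → Sized s B →
    ∃[ X′ ] X′ ⊆ X × m₃ ≤ length X′ × ∃[ B′ ] B′ ⊆ᵍ B × Sized T B′ ×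
      ((∀ {y} → y ∈ᵍ B′ → ConstantOn (column c y) X′) ⊎ (∀ {y} → y ∈ᵍ B′ → InjectiveOn (column c y) X′))
  uniformColumns X X-unique m₂≤ B sizedB with trim s B sizedB
  ... | B₁ , B₁⊆B , sizedB₁ , |points|
    with constant-or-injective-all ℕ._≟_ (map (column c) (points B₁)) X
           (subst (λ n → iterSq n m₃ ≤ length X) (sym (trans (length-map (column c) (points B₁)) |points|)) m₂≤)
  ... | X′ , X′⊆X , m₃≤ , cois
    with two-distinct (AllPairs-resp-⊆ X′⊆X X-unique) (≤-trans (≤-trans (s≤s (s≤s z≤n)) T≤m₃) m₃≤)
  ... | xa , xb , xa∈ , xb∈ , xa≢xb
    with monochromatic-subgrid IH (λ y → c (xa ∷ y) ℕ.≟ c (xb ∷ y)) (s≤s (s≤s (s≤s z≤n))) B₁ sizedB₁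
  ... | B′ , B′⊆B₁ , sizedB′ , aligned =
    X′ , X′⊆X , m₃≤ , B′ , ⊆ᵍ-trans B′⊆B₁ B₁⊆B , sizedB′ ,
    Sum.map (λ all-aligned y∈ → proj₁ (resolve y∈) (all-aligned y∈))
            (λ none-aligned y∈ → proj₂ (resolve y∈) (none-aligned y∈)) aligned
    where
      resolve : ∀ {y} → y ∈ᵍ B′ → (c (xa ∷ y) ≡ c (xb ∷ y) → ConstantOn (column c y) X′)
                                  × (c (xa ∷ y) ≢ c (xb ∷ y) → InjectiveOn (column c y) X′)
      resolve y∈ = ConstantOrInjectiveOn-resolve xa∈ xb∈
                     (All.lookup (All.map⁻ cois) (∈ᵍ⇒∈-points (∈ᵍ-resp-⊆ᵍ B′⊆B₁ y∈))) xa≢xb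

  separateRows : ∀ {J} (X : List A) → m₃ ≤ length X → (B : Grid A r) → Sized T B → RowsCanonical c J X B →
    (∀ {y} → y ∈ᵍ B → InjectiveOn (column c y) X) →
    ∃[ X′ ] X′ ⊆ X × T ≤ length X′ × ∃[ B′ ] B′ ⊆ᵍ B × Sized T B′ × CanonicalOn (inside ∷ J) (X′ ∷ B′) c
  separateRows X m₃≤ B sizedB rows columns-inj with trim T B sizedB
  ... | B′ , B′⊆B , sizedB′ , |points| =
    independent (conflict? c (points B′)) T X , independent-⊆ _ T X , length-independent _ T X degree m₃≤ ,
    B′ , B′⊆B , sizedB′ ,
    canonical-separatedRows c (RowsCanonical-resp c (independent-⊆ _ T X) B′⊆B rows)
      (AllPairs.map (¬Conflict⇒Separated c) (independent-AllPairs _ T X))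
    where
      degree : ∀ x → length (filter (conflict? c (points B′) x) X) ≤ T ^ r * T ^ r
      degree x = subst (λ n → _ ≤ n * n) |points|
                   (conflict-degree c (λ y∈ → columns-inj (∈ᵍ-resp-⊆ᵍ B′⊆B (∈-points⇒∈ᵍ y∈))) x)

  step : (G : Grid A (suc r)) → Sized N G → ∃[ G′ ] G′ ⊆ᵍ G × Sized T G′ × ∃[ J ] CanonicalOn J G′ c
  step (X₀ ∷ B₀) ((X₀-unique , N≤) ∷ sized)
    with uniformRows X₀ B₀ (≤-trans (m≤m+n m₁ _) N≤) (Sized-weaken (m≤n+m _ m₁) sized)
  ... | X₁ , X₁⊆X₀ , m₂≤ , B₁ , B₁⊆B₀ , sized₁ , J , rows₁
    with uniformColumns X₁ (AllPairs-resp-⊆ X₁⊆X₀ X₀-unique) m₂≤ B₁ sized₁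
  ... | X₂ , X₂⊆X₁ , m₃≤ , B₂ , B₂⊆B₁ , sized₂ , inj₁ constant =
    X₂ ∷ B₂ , ⊆-trans X₂⊆X₁ X₁⊆X₀ ∷ ⊆ᵍ-trans B₂⊆B₁ B₁⊆B₀ ,
    (AllPairs-resp-⊆ (⊆-trans X₂⊆X₁ X₁⊆X₀) X₀-unique , ≤-trans T≤m₃ m₃≤) ∷ sized₂ ,
    outside ∷ J , canonical-constantColumns c (RowsCanonical-resp c X₂⊆X₁ B₂⊆B₁ rows₁) constant
  ... | X₂ , X₂⊆X₁ , m₃≤ , B₂ , B₂⊆B₁ , sized₂ , inj₂ injective
    with separateRows X₂ m₃≤ B₂ sized₂ (RowsCanonical-resp c X₂⊆X₁ B₂⊆B₁ rows₁) injective
  ... | X₃ , X₃⊆X₂ , T≤ , B₃ , B₃⊆B₂ , sized₃ , can =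
    X₃ ∷ B₃ , X₃⊆X₀ ∷ ⊆ᵍ-trans B₃⊆B₂ (⊆ᵍ-trans B₂⊆B₁ B₁⊆B₀) , (AllPairs-resp-⊆ X₃⊆X₀ X₀-unique , T≤) ∷ sized₃ ,
    inside ∷ J , can
    where
      X₃⊆X₀ = ⊆-trans X₃⊆X₂ (⊆-trans X₂⊆X₁ X₁⊆X₀)

canonicalRamsey : ∀ {A} r t → CanonicalRamseyAt A r t (ramseyBound r t)
canonicalRamsey zero    t [] [] c = [] , [] , [] , [] , λ { {[]} {[]} _ _ → mk⇔ (λ _ ()) (λ _ → refl) }
canonicalRamsey (suc r) t G sized c with Step.step r t (canonicalRamsey r) c G sized
... | G′ , G′⊆G , sized′ , J , can = G′ , G′⊆G , Sized-weaken (m≤n+m t 3) sized′ , J , can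

-- Copies and canonical colorings of K^(r)_{t,…,t}

-- Routed through Vec.tabulate so that c ∘ push (embedding sized) is definitionally
-- (c ∘ Vec.lookup) ∘ embed sized; without function extensionality they could not be identified.
push : ∀ {r a b} → (Fin r → Fin a → Fin b) → KEdge r a → KEdge r b
push σ k = Vec.lookup (Vec.tabulate (λ j → σ j (k j)))

liftCopy : ∀ {r a b} {X : RPGraph r} (σ : Fin r → Fin a → Fin b) → (∀ j → Injective _≡_ _≡_ (σ j)) →
           Copy X a → Copy X b
liftCopy {r} {a} {b} σ σ-injective C = record
  { φ          = F ∘ φ C
  ; φ-inj      = φ-inj C ∘ F-injective
  ; image      = λ e p → push σ (image C e p)
  ; image-spec = λ e p → Product.map (λ spec j → Product.map₂ F-spec (spec j))
                                     (λ spec i → Product.map₂ F-spec (spec i)) (image-spec C e p)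
  }
  where
    F : Fin r × Fin a → Fin r × Fin b
    F (j , x) = j , σ j x

    F-injective : Injective _≡_ _≡_ F
    F-injective {j , x} {j′ , x′} Fx≡Fx′ with refl ← cong proj₁ Fx≡Fx′ = cong (j ,_) (σ-injective j (cong proj₂ Fx≡Fx′))

    F-spec : {v : Fin r × Fin a} {j : Fin r} {k : KEdge r a} → v ≡ (j , k j) → F v ≡ (j , push σ k j)
    F-spec {j = j} {k} refl = cong (j ,_) (sym (lookup∘tabulate (λ j → σ j (k j)) j))

funToFin-cong : ∀ {m n} {f g : Fin m → Fin n} → (∀ i → f i ≡ g i) → funToFin f ≡ funToFin g
funToFin-cong {zero}  _   = refl
funToFin-cong {suc m} f≗g = cong₂ combine (f≗g zero) (funToFin-cong (f≗g ∘ suc))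

funToFin-injective : ∀ {m n} {f g : Fin m → Fin n} → funToFin f ≡ funToFin g → ∀ i → f i ≡ g i
funToFin-injective {f = f} {g} same i =
  trans (sym (finToFun-funToFin f i)) (trans (cong (λ x → finToFun x i) same) (finToFun-funToFin g i))

module _ {r n : ℕ} (J : Subset r) where

  mask : KEdge r n → Fin r → Fin (suc n)
  mask k j with j ∈? J
  ... | yes _ = suc (k j)
  ... | no  _ = zero

  mask-≡⇒ : ∀ {k k′ j} → mask k j ≡ mask k′ j → j ∈ₛ J → k j ≡ k′ j
  mask-≡⇒ {j = j} same j∈J with j ∈? J
  ... | yes _   = Fin.suc-injective same
  ... | no  j∉J = ⊥-elim (j∉J j∈J)

  mask-cong : ∀ {k k′ j} → (j ∈ₛ J → k j ≡ k′ j) → mask k j ≡ mask k′ j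
  mask-cong {j = j} agree with j ∈? J
  ... | yes j∈J = cong suc (agree j∈J)
  ... | no  _   = refl

  canonicalColoring : Coloring r n
  canonicalColoring k = toℕ (funToFin (mask k))

  canonicalColoring-canonical : Canonical J canonicalColoring
  canonicalColoring-canonical k k′ =
    (λ same j → mask-≡⇒ (funToFin-injective (Fin.toℕ-injective same) j)) ,
    (λ agree → cong toℕ (funToFin-cong λ j → mask-cong (agree j)))

module _ {r t : ℕ} {J : Subset r} {c₀ c₁ : Coloring r t} (can₀ : Canonical J c₀) (can₁ : Canonical J c₁) where

  Canonical-sameKernel : ∀ k k′ → c₀ k ≡ c₀ k′ ⇔ c₁ k ≡ c₁ k′
  Canonical-sameKernel k k′ = mk⇔ (proj₂ (can₁ k k′) ∘ proj₁ (can₀ k k′)) (proj₂ (can₀ k k′) ∘ proj₁ (can₁ k k′))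

  -- A copy may have no edges, so the new color is found by searching all edges of K_t.
  Canonical-recolor : ∀ γ → ∃[ γ′ ] ∀ k → c₀ k ≡ γ → c₁ k ≡ γ′
  Canonical-recolor γ with Fin.any? (λ i → c₀ (finToFun i) ℕ.≟ γ)
  ... | yes (i , c₀i≡γ) = c₁ (finToFun i) , λ k c₀k≡γ →
    Equivalence.to (Canonical-sameKernel k (finToFun i)) (trans c₀k≡γ (sym c₀i≡γ))
  ... | no  none        = 0 , λ k c₀k≡γ →
    ⊥-elim (none (funToFin k , trans (proj₂ (can₀ _ k) (λ j _ → finToFun-funToFin k j)) c₀k≡γ))

  Monochromatic-transfer : ∀ {X : RPGraph r} {C : Copy X t} → Monochromatic c₀ C → Monochromatic c₁ C
  Monochromatic-transfer (γ , mono) with Canonical-recolor γ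
  ... | γ′ , recolor = γ′ , λ e p → recolor _ (mono e p)

  Rainbow-transfer : ∀ {X : RPGraph r} {C : Copy X t} → Rainbow c₀ C → Rainbow c₁ C
  Rainbow-transfer rainbow e p e′ p′ same = rainbow e p e′ p′ (Equivalence.from (Canonical-sameKernel _ _) same)

module _ {r : ℕ} (H G : RPGraph r) where

  CanonicalWitness : ℕ → Subset r → Set
  CanonicalWitness t J =
      (∃ λ (c : Coloring r t) → Canonical J c × ∃ λ (C : Copy H t) → Monochromatic c C)
    ⊎ (∃ λ (c : Coloring r t) → Canonical J c × ∃ λ (C : Copy G t) → Rainbow c C)

  arrows⇒canonicalWitness : ∀ {n} → Arrows n H G → ∀ J → CanonicalWitness (suc n) J
  arrows⇒canonicalWitness {n} arrows J =
    Sum.map (λ (C , mono)    → canonicalColoring J , canonicalColoring-canonical J , lift C , mono)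
            (λ (C , rainbow) → canonicalColoring J , canonicalColoring-canonical J , lift C , rainbow)
            (arrows (canonicalColoring J ∘ push (λ _ → inject₁)))
    where
      lift : ∀ {X : RPGraph r} → Copy X n → Copy X (suc n)
      lift = liftCopy (λ _ → inject₁) (λ _ → Fin.inject₁-injective)

  canonicalWitness⇒arrows : ∀ {t} → (∀ J → CanonicalWitness t J) → Arrows (ramseyBound r t) H G
  canonicalWitness⇒arrows {t} witness c
    with canonicalRamsey r t (Vec.replicate r (allFin N))
                             (Sized-replicate r (allFin⁺ N) (≤-reflexive (sym (length-tabulate id)))) (c ∘ Vec.lookup)
    where N = ramseyBound r t
  ... | _ , _ , sized , J , can with witness J
  ... | inj₁ (_ , can₀ , C , mono)    = inj₁ (liftCopy _ (embedding-injective sized) C ,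
                                              Monochromatic-transfer can₀ (CanonicalOn⇒Canonical sized can) {C = C} mono)
  ... | inj₂ (_ , can₀ , C , rainbow) = inj₂ (liftCopy _ (embedding-injective sized) C ,
                                              Rainbow-transfer can₀ (CanonicalOn⇒Canonical sized can) {C = C} rainbow)

proposition1p1 : ∀ (r : ℕ) → 2 ≤ r → (H G : RPGraph r) →
    FPrimeExists H G ⇔
      (∃ λ (t : ℕ) → 1 ≤ t × (∀ (J : Subset r) →
          (∃ λ (c : Coloring r t) → Canonical J c × ∃ λ (C : Copy H t) → Monochromatic c C)
        ⊎ (∃ λ (c : Coloring r t) → Canonical J c × ∃ λ (C : Copy G t) → Rainbow c C)))
proposition1p1 r _ H G = mk⇔
  (λ (n , arrows) → suc n , s≤s z≤n , arrows⇒canonicalWitness H G arrows)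
  (λ (t , _ , witness) → ramseyBound r t , canonicalWitness⇒arrows H G witness)
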